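{- Let $n\ge1$ and $w\ge1$. There is a bijection between step polyominoes of width $w$ and height $n+1$ and Young diagrams (of partitions) which fit inside the staircase shape $(n-1,n-2,\ldots,1)$ and have exactly $w-1$ corners.
   Context: A parallelogram polyomino is a finite union of unit cells of the plane bounded by two lattice paths that start at the origin, use only unit steps north $[0,1]$ and east $[1,0]$, end at a common point, and meet only at their start and end points; its width and height are the coordinates of the common end point. A step polyomino is a parallelogram polyomino in which every horizontal boundary segment has length $1$, i.e. neither boundary path contains two consecutive east steps. A Young diagram fits inside $(n-1,n-2,\ldots,1)$ if its partition $\Lambda$ satisfies $\Lambda_i\le n-i$ for all $i$; its corners are the cells $(i,\Lambda_i)$ with $\Lambda_i>\Lambda_{i+1}$ (equivalently, their number is the number of distinct nonzero parts of $\Lambda$). -}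

module Defs where

open import Data.Nat using (ℕ; zero; suc; _+_; _∸_; _≤_; _<_; _≥_)
open import Data.Nat.Base using (_<ᵇ_)
open import Data.Bool using (if_then_else_)
open import Data.List using (List; []; _∷_; length; take; lookup)
open import Data.List.Relation.Unary.All using (All)
open import Data.List.Relation.Unary.Linked using (Linked)
open import Data.Fin using (Fin; toℕ)
open import Data.Product using (Σ; _×_; _,_; proj₁; ∃)
open import Data.Sum using (_⊎_)
open import Data.Empty using (⊥)
open import Data.Unit using (⊤)
open import Relation.Binary.PropositionalEquality using (_≡_)

data Step : Set where
  N E : Step

pos : List Step → ℕ × ℕ
pos [] = 0 , 0
pos (N ∷ s) with pos s
... | x , y = x , suc y
pos (E ∷ s) with pos s
... | x , y = suc x , y

MeetOnlyAtEnds : List Step → List Step → Set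
MeetOnlyAtEnds p q =
  ∀ i j → i ≤ length p → j ≤ length q →
  pos (take i p) ≡ pos (take j q) →
  (i ≡ 0 × j ≡ 0) ⊎ (i ≡ length p × j ≡ length q)

-- a parallelogram polyomino, given by its upper path (first step north)
-- and its lower path; both start at the origin, end at a common point and
-- meet only at the start and end points.
StartsNorth : List Step → Set
StartsNorth (N ∷ _) = ⊤
StartsNorth _ = ⊥

IsParallelogram : List Step × List Step → Set
IsParallelogram (up , lo) =
  StartsNorth up × pos up ≡ pos lo × MeetOnlyAtEnds up lo

width height : List Step × List Step → ℕ
width (up , _) = proj₁ (pos up)
height (up , _) = Data.Product.proj₂ (pos up)

NoEE : List Step → Set
NoEE [] = ⊤
NoEE (N ∷ s) = NoEE s
NoEE (E ∷ []) = ⊤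
NoEE (E ∷ N ∷ s) = NoEE (N ∷ s)
NoEE (E ∷ E ∷ s) = ⊥

IsStepPolyomino : List Step × List Step → Set
IsStepPolyomino P = IsParallelogram P × NoEE (proj₁ P) × NoEE (Data.Product.proj₂ P)

IsPartition : List ℕ → Set
IsPartition Λ = All (λ a → 1 ≤ a) Λ × Linked _≥_ Λ

FitsStaircase : ℕ → List ℕ → Set
FitsStaircase n Λ = ∀ (i : Fin (length Λ)) → lookup Λ i ≤ n ∸ suc (toℕ i)

-- number of corners: cells (i, Λ_i) with Λ_i > Λ_{i+1} (Λ_{i} = 0 beyond the length)
corners : List ℕ → ℕ
corners [] = 0
corners (a ∷ []) = if 0 <ᵇ a then 1 else 0
corners (a ∷ b ∷ r) = (if b <ᵇ a then 1 else 0) + corners (b ∷ r)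

-- bijection between the underlying objects (equality = equality of the
-- underlying data, proofs of the defining properties are irrelevant)

Bijective : {A B : Set} {P : A → Set} {Q : B → Set} → Set
Bijective {A} {B} {P} {Q} =
  Σ (Σ A P → Σ B Q) λ f → Σ (Σ B Q → Σ A P) λ g →
    (∀ x → proj₁ (g (f x)) ≡ proj₁ x) × (∀ y → proj₁ (f (g y)) ≡ proj₁ y)

-- The upper path of a step polyomino of width w and height n + 1 is N^a₁ E N^a₂ E ⋯ N^a_w E and
-- its lower path is E N^b₁ E N^b₂ ⋯ E N^b_w, for two compositions a and b of n + 1 into w parts;
-- the paths meet only at their ends exactly when b₁ + ⋯ + b_i < a₁ + ⋯ + a_i for every i < w.
-- Send (a, b) to the Young diagram whose distinct parts are the suffix sums a_{i+1} + ⋯ + a_w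
-- (i < w), the i-th one repeated b_i times. These w − 1 distinct parts give w − 1 corners, and
-- since a_{i+1} + ⋯ + a_w = n + 1 − (a₁ + ⋯ + a_i), the partial-sum inequalities say exactly that
-- the last row of each block, row b₁ + ⋯ + b_i, fits in the staircase. Conversely, both
-- compositions are read off from the run-length encoding of the diagram.

module Submission where

open import Defs
open import Data.Nat
  using (ℕ; zero; suc; pred; _+_; _∸_; _≤_; _<_; _≥_; _>_; _≟_; _<?_; _<ᵇ_; z≤n; s≤s; s≤s⁻¹)
open import Data.Nat.Properties
open import Data.Nat.Tactic.RingSolver using (solve-∀)
open import Data.Bool using (true; false)
open import Data.List using (List; []; _∷_; [_]; length; take; drop; lookup; replicate; _++_)
import Data.List as List
open import Data.List.Properties using (length-take; take-all; length-++)
open import Data.List.Relation.Unary.All using ([]; _∷_)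
open import Data.List.Relation.Unary.All.Properties using (++⁺; replicate⁺)
open import Data.List.Relation.Unary.Linked as Linked using (Linked; []; [-]; _∷_; _∷′_)
open import Data.Maybe using (just)
open import Data.Maybe.Relation.Binary.Connected using (Connected; just; just-nothing)
open import Data.Fin as Fin using (toℕ)
open import Data.Product using (∃-syntax; _×_; _,_; proj₁; proj₂)
open import Data.Sum using (_⊎_; inj₁; inj₂)
open import Data.Empty using (⊥-elim)
open import Data.Unit using (⊤; tt)
open import Function using (_on_)
open import Relation.Nullary using (yes; no)
open import Relation.Binary.PropositionalEquality
  using (_≡_; _≢_; refl; sym; trans; cong; cong₂; subst; subst₂; ≢-sym; module ≡-Reasoning)

record Correspondence {A B : Set} (P : A → Set) (Q : B → Set) : Set where
  field
    to             : A → B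
    from           : B → A
    to-preserves   : ∀ x → P x → Q (to x)
    from-preserves : ∀ y → Q y → P (from y)
    from∘to        : ∀ x → P x → from (to x) ≡ x
    to∘from        : ∀ y → Q y → to (from y) ≡ y

module _ {A B C : Set} {P : A → Set} {Q : B → Set} {R : C → Set} where
  open Correspondence

  infixr 9 _⨾_
  _⨾_ : Correspondence P Q → Correspondence Q R → Correspondence P R
  (f ⨾ g) .to x = to g (to f x)
  (f ⨾ g) .from z = from f (from g z)
  (f ⨾ g) .to-preserves x px = to-preserves g _ (to-preserves f x px)
  (f ⨾ g) .from-preserves z rz = from-preserves f _ (from-preserves g z rz)
  (f ⨾ g) .from∘to x px =
    trans (cong (from f) (from∘to g _ (to-preserves f x px))) (from∘to f x px)
  (f ⨾ g) .to∘from z rz =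
    trans (cong (to g) (to∘from f _ (from-preserves g z rz))) (to∘from g z rz)

correspondence⇒bijective : {A B : Set} {P : A → Set} {Q : B → Set} →
  Correspondence P Q → Bijective {A} {B} {P} {Q}
correspondence⇒bijective c =
  (λ (x , px) → to x , to-preserves x px) ,
  (λ (y , qy) → from y , from-preserves y qy) ,
  (λ (x , px) → from∘to x px) ,
  (λ (y , qy) → to∘from y qy)
  where open Correspondence c

-- Lattice points of a path

endX endY : List Step → ℕ
endX s = proj₁ (pos s)
endY s = proj₂ (pos s)

endX+endY≡length : ∀ s → endX s + endY s ≡ length s
endX+endY≡length [] = refl
endX+endY≡length (N ∷ s) = trans (+-suc (endX s) (endY s)) (cong suc (endX+endY≡length s))
endX+endY≡length (E ∷ s) = cong suc (endX+endY≡length s)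

length≡endX+endY : ∀ {s x y} → pos s ≡ (x , y) → length s ≡ x + y
length≡endX+endY {s} e = trans (sym (endX+endY≡length s)) (cong (λ (x , y) → x + y) e)

endX+endY-take : ∀ i s → i ≤ length s → endX (take i s) + endY (take i s) ≡ i
endX+endY-take i s i≤ =
  trans (endX+endY≡length (take i s)) (trans (length-take i s) (m≤n⇒m⊓n≡m i≤))

endX≡suc⇒1≤length : ∀ {k} s → endX s ≡ suc k → 1 ≤ length s
endX≡suc⇒1≤length s e = ≤-trans (s≤s z≤n)
  (subst (_≤ length s) e (subst (endX s ≤_) (endX+endY≡length s) (m≤m+n (endX s) (endY s))))

endY-++ : ∀ s t → endY (s ++ t) ≡ endY s + endY t
endY-++ [] t = refl
endY-++ (N ∷ s) t = cong suc (endY-++ s t)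
endY-++ (E ∷ s) t = endY-++ s t

take-length-++ : ∀ (xs ys : List Step) → take (length xs) (xs ++ ys) ≡ xs
take-length-++ [] ys = refl
take-length-++ (x ∷ xs) ys = cong (x ∷_) (take-length-++ xs ys)

endY-take-length : ∀ s → endY (take (length s) s) ≡ endY s
endY-take-length s = cong endY (take-all (length s) s ≤-refl)

length-snoc : ∀ (xs : List Step) x → length (xs ++ [ x ]) ≡ suc (length xs)
length-snoc xs x = trans (length-++ xs) (+-comm (length xs) 1)

endY-take-≤-suc : ∀ i s → endY (take i s) ≤ endY (take (suc i) s)
endY-take-≤-suc zero s = z≤n
endY-take-≤-suc (suc i) [] = z≤n
endY-take-≤-suc (suc i) (N ∷ s) = s≤s (endY-take-≤-suc i s)
endY-take-≤-suc (suc i) (E ∷ s) = endY-take-≤-suc i s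

endY-take-suc-≤ : ∀ i s → endY (take (suc i) s) ≤ suc (endY (take i s))
endY-take-suc-≤ i [] = z≤n
endY-take-suc-≤ zero (N ∷ s) = s≤s z≤n
endY-take-suc-≤ (suc i) (N ∷ s) = s≤s (endY-take-suc-≤ i s)
endY-take-suc-≤ zero (E ∷ s) = z≤n
endY-take-suc-≤ (suc i) (E ∷ s) = endY-take-suc-≤ i s

data OnPath : List Step → ℕ → ℕ → Set where
  origin  : ∀ {s} → OnPath s 0 0
  after-N : ∀ {s x y} → OnPath s x y → OnPath (N ∷ s) x (suc y)
  after-E : ∀ {s x y} → OnPath s x y → OnPath (E ∷ s) (suc x) y

onPath-take : ∀ i s → OnPath s (endX (take i s)) (endY (take i s))
onPath-take zero s = origin
onPath-take (suc i) [] = origin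
onPath-take (suc i) (N ∷ s) = after-N (onPath-take i s)
onPath-take (suc i) (E ∷ s) = after-E (onPath-take i s)

pos-take-onPath : ∀ {s x y} → OnPath s x y → pos (take (x + y) s) ≡ (x , y)
pos-take-onPath origin = refl
pos-take-onPath (after-N {s} {x} {y} p) rewrite +-suc x y | pos-take-onPath p = refl
pos-take-onPath (after-E p) rewrite pos-take-onPath p = refl

onPath-bounded : ∀ {s x y} → OnPath s x y → x ≤ endX s × y ≤ endY s
onPath-bounded origin = z≤n , z≤n
onPath-bounded (after-N p) = proj₁ (onPath-bounded p) , s≤s (proj₂ (onPath-bounded p))
onPath-bounded (after-E p) = s≤s (proj₁ (onPath-bounded p)) , proj₂ (onPath-bounded p)

onPath-length : ∀ {s x y} → OnPath s x y → x + y ≤ length s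
onPath-length {s} p = subst (_ ≤_) (endX+endY≡length s)
  (+-mono-≤ (proj₁ (onPath-bounded p)) (proj₂ (onPath-bounded p)))

onPath-N-run : ∀ k {t x y} → OnPath (replicate k N ++ t) x y →
  (x ≡ 0 × y ≤ k) ⊎ ∃[ y′ ] y ≡ k + y′ × OnPath t x y′
onPath-N-run zero p = inj₂ (_ , refl , p)
onPath-N-run (suc k) origin = inj₁ (refl , z≤n)
onPath-N-run (suc k) (after-N p) with onPath-N-run k p
... | inj₁ (x≡0 , y≤k) = inj₁ (x≡0 , s≤s y≤k)
... | inj₂ (y′ , refl , q) = inj₂ (y′ , refl , q)

onPath-N-run-below : ∀ {k t y} → y ≤ k → OnPath (replicate k N ++ t) 0 y
onPath-N-run-below z≤n = origin
onPath-N-run-below (s≤s y≤k) = after-N (onPath-N-run-below y≤k)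

onPath-N-run-after : ∀ k {t x y} → OnPath t x y → OnPath (replicate k N ++ t) x (k + y)
onPath-N-run-after zero p = p
onPath-N-run-after (suc k) p = after-N (onPath-N-run-after k p)

-- The paths of a pair of compositions

-- A part p stands for p + 1, so that every list of naturals encodes a composition.
total : List ℕ → ℕ
total [] = 0
total (p ∷ ps) = suc (p + total ps)

upperPath : List ℕ → List Step
upperPath [] = []
upperPath (p ∷ ps) = replicate (suc p) N ++ E ∷ upperPath ps

lowerPath : List ℕ → List Step
lowerPath [] = []
lowerPath (q ∷ qs) = E ∷ replicate (suc q) N ++ lowerPath qs

pos-N-run : ∀ k t → pos (replicate k N ++ t) ≡ (endX t , k + endY t)
pos-N-run zero t = refl
pos-N-run (suc k) t rewrite pos-N-run k t = refl

pos-upperPath : ∀ ps → pos (upperPath ps) ≡ (length ps , total ps)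
pos-upperPath [] = refl
pos-upperPath (p ∷ ps) rewrite pos-N-run p (E ∷ upperPath ps) | pos-upperPath ps = refl

pos-lowerPath : ∀ qs → pos (lowerPath qs) ≡ (length qs , total qs)
pos-lowerPath [] = refl
pos-lowerPath (q ∷ qs) rewrite pos-N-run q (lowerPath qs) | pos-lowerPath qs = refl

length-upperPath : ∀ ps → length (upperPath ps) ≡ length ps + total ps
length-upperPath ps = length≡endX+endY (pos-upperPath ps)

length-lowerPath : ∀ qs → length (lowerPath qs) ≡ length qs + total qs
length-lowerPath qs = length≡endX+endY (pos-lowerPath qs)

common-end : ∀ ps qs → pos (upperPath ps) ≡ pos (lowerPath qs) →
  length ps ≡ length qs × total ps ≡ total qs
common-end ps qs same = cong proj₁ end , cong proj₂ end
  where end = trans (sym (pos-upperPath ps)) (trans same (pos-lowerPath qs))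

noEE-N-run : ∀ k {t} → NoEE t → NoEE (replicate k N ++ t)
noEE-N-run zero h = h
noEE-N-run (suc k) h = noEE-N-run k h

noEE-upperPath : ∀ ps → NoEE (upperPath ps)
noEE-upperPath [] = tt
noEE-upperPath (p ∷ []) = noEE-N-run p tt
noEE-upperPath (p ∷ ps@(_ ∷ _)) = noEE-N-run p (noEE-upperPath ps)

noEE-lowerPath : ∀ qs → NoEE (lowerPath qs)
noEE-lowerPath [] = tt
noEE-lowerPath (q ∷ qs) = noEE-N-run q (noEE-lowerPath qs)

-- The lengths, minus one, of the N-runs closed by the E steps; `end` handles the final run,
-- which in a lower path is not followed by E.
blocks : (ℕ → List ℕ) → ℕ → List Step → List ℕ
blocks end k [] = end k
blocks end k (N ∷ s) = blocks end (suc k) s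
blocks end k (E ∷ s) = pred k ∷ blocks end 0 s

upperParts : List Step → List ℕ
upperParts = blocks (λ _ → []) 0

lowerParts : List Step → List ℕ
lowerParts (E ∷ s) = blocks (λ k → [ pred k ]) 0 s
lowerParts _ = []

blocks-N-run : ∀ end j k s → blocks end k (replicate j N ++ s) ≡ blocks end (j + k) s
blocks-N-run end zero k s = refl
blocks-N-run end (suc j) k s =
  trans (blocks-N-run end j (suc k) s) (cong (λ i → blocks end i s) (+-suc j k))

upperParts-upperPath : ∀ ps → upperParts (upperPath ps) ≡ ps
upperParts-upperPath [] = refl
upperParts-upperPath (p ∷ ps) =
  trans (blocks-N-run _ (suc p) 0 (E ∷ upperPath ps))
        (cong₂ _∷_ (+-identityʳ p) (upperParts-upperPath ps))

blocks-lowerPath : ∀ k qs → blocks (λ k → [ pred k ]) k (lowerPath qs) ≡ pred k ∷ qs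
blocks-lowerPath k [] = refl
blocks-lowerPath k (q ∷ qs) =
  cong (pred k ∷_) (trans (blocks-N-run _ (suc q) 0 (lowerPath qs))
                          (trans (blocks-lowerPath (suc q + 0) qs) (cong (_∷ qs) (+-identityʳ q))))

lowerParts-lowerPath : ∀ qs → lowerParts (lowerPath qs) ≡ qs
lowerParts-lowerPath [] = refl
lowerParts-lowerPath (q ∷ qs) =
  trans (blocks-N-run _ (suc q) 0 (lowerPath qs))
        (trans (blocks-lowerPath (suc q + 0) qs) (cong (_∷ qs) (+-identityʳ q)))

-- Non-crossing paths

-- d is the vertical gap between the paths before a column; after a column with parts p + 1 and
-- q + 1 it becomes d′, which has to stay positive until the last column.
data Separated : ℕ → List ℕ → List ℕ → Set where
  last : ∀ {d p q} → Separated d [ p ] [ q ]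
  next : ∀ {d p q ps qs} d′ → d + suc p ≡ suc q + d′ → 1 ≤ d′ →
         Separated d′ ps qs → Separated d (p ∷ ps) (q ∷ qs)

separated-length : ∀ {d ps qs} → Separated d ps qs → length ps ≡ length qs
separated-length last = refl
separated-length (next _ _ _ sep) = cong suc (separated-length sep)

column-gap : ∀ {p q d d′} y → d + suc p ≡ suc q + d′ → suc p + y + d ≡ suc q + (y + d′)
column-gap {p} {q} {d} {d′} y balance = begin
  suc p + y + d    ≡⟨ shuffle p y d ⟩
  y + (d + suc p)  ≡⟨ cong (y +_) balance ⟩
  y + (suc q + d′) ≡⟨ swap y (suc q) d′ ⟩
  suc q + (y + d′) ∎
  where
    open ≡-Reasoning
    shuffle : ∀ p y d → suc p + y + d ≡ y + (d + suc p)
    shuffle = solve-∀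
    swap : ∀ a b c → a + (b + c) ≡ b + (a + c)
    swap = solve-∀

TouchOnlyAtEnds : ℕ → List ℕ → List ℕ → Set
TouchOnlyAtEnds d ps qs =
  ∀ {x y} → OnPath (upperPath ps) x y → OnPath (lowerPath qs) x (y + d) →
  (x ≡ 0 × y ≡ 0) ⊎ (x ≡ length ps × y ≡ total ps)

onLowerPath-x≡0 : ∀ qs {y} → OnPath (lowerPath qs) 0 y → y ≡ 0
onLowerPath-x≡0 [] origin = refl
onLowerPath-x≡0 (q ∷ qs) origin = refl

onUpperPath-∷⁻ : ∀ p ps {x y} → OnPath (upperPath (p ∷ ps)) (suc x) y →
  ∃[ y′ ] y ≡ suc p + y′ × OnPath (upperPath ps) x y′
onUpperPath-∷⁻ p ps u with onPath-N-run (suc p) u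
... | inj₁ (() , _)
... | inj₂ (y′ , y≡ , after-E u′) = y′ , y≡ , u′

onUpperPath-∷⁺ : ∀ p ps {x y} → OnPath (upperPath ps) x y →
  OnPath (upperPath (p ∷ ps)) (suc x) (suc p + y)
onUpperPath-∷⁺ p ps u = onPath-N-run-after (suc p) (after-E u)

onLowerPath-∷⁻ : ∀ q qs {x z} → OnPath (lowerPath (q ∷ qs)) (suc x) z →
  (x ≡ 0 × z ≤ suc q) ⊎ ∃[ z′ ] z ≡ suc q + z′ × OnPath (lowerPath qs) x z′
onLowerPath-∷⁻ q qs (after-E l) = onPath-N-run (suc q) l

separated⇒touchOnlyAtEnds : ∀ {d ps qs} → Separated d ps qs → TouchOnlyAtEnds d ps qs
separated⇒touchOnlyAtEnds {qs = qs} _ {zero} {y} _ l =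
  inj₁ (refl , m+n≡0⇒m≡0 y (onLowerPath-x≡0 qs l))
separated⇒touchOnlyAtEnds (last {p = p}) {suc x} u _ with onUpperPath-∷⁻ p [] u
... | _ , y≡ , origin = inj₂ (refl , y≡)
separated⇒touchOnlyAtEnds (next {d} {p} {q} {ps} {qs} d′ balance d′≥1 sep) {suc x} u l
  with onUpperPath-∷⁻ p ps u
... | y′ , refl , u′ with onLowerPath-∷⁻ q qs l
...   | inj₁ (_ , y+d≤1+q) =
        ⊥-elim (<⇒≱ (subst (suc q <_) (sym (column-gap {p} {q} {d} {d′} y′ balance))
                              (m<m+n (suc q) (≤-trans d′≥1 (m≤n+m d′ y′))))
                     y+d≤1+q)
...   | inj₂ (z , z≡ , l′)
        with +-cancelˡ-≡ (suc q) z (y′ + d′) (trans (sym z≡) (column-gap {p} {q} {d} {d′} y′ balance))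
...     | refl with separated⇒touchOnlyAtEnds sep u′ l′
...       | inj₁ (refl , refl) = ⊥-elim (<⇒≢ d′≥1 (sym (onLowerPath-x≡0 qs l′)))
...       | inj₂ (x≡ , y′≡) = inj₂ (cong suc x≡ , cong (suc p +_) y′≡)

touchOnlyAtEnds⇒separated : ∀ {d} p ps q qs → length ps ≡ length qs →
  TouchOnlyAtEnds d (p ∷ ps) (q ∷ qs) → Separated d (p ∷ ps) (q ∷ qs)
touchOnlyAtEnds⇒separated p [] q [] _ _ = last
touchOnlyAtEnds⇒separated {d} p (p′ ∷ ps) q (q′ ∷ qs) len touch with suc q <? d + suc p
... | no lower≮upper
  with touch (onUpperPath-∷⁺ p (p′ ∷ ps) origin) (after-E (onPath-N-run-below upper≤lower))
  where
    upper≤lower : suc p + 0 + d ≤ suc q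
    upper≤lower =
      ≤-trans (≤-reflexive (trans (cong (_+ d) (+-identityʳ (suc p))) (+-comm (suc p) d)))
              (≮⇒≥ lower≮upper)
...   | inj₁ (() , _)
...   | inj₂ (() , _)
touchOnlyAtEnds⇒separated {d} p (p′ ∷ ps) q (q′ ∷ qs) len touch | yes lower<upper =
  next d′ balance (m<n⇒0<n∸m lower<upper)
       (touchOnlyAtEnds⇒separated p′ ps q′ qs (suc-injective len) touch′)
  where
    d′ = d + suc p ∸ suc q
    balance : d + suc p ≡ suc q + d′
    balance = sym (m+[n∸m]≡n (<⇒≤ lower<upper))
    touch′ : TouchOnlyAtEnds d′ (p′ ∷ ps) (q′ ∷ qs)
    touch′ {x} {y} u l
      with touch (onUpperPath-∷⁺ p (p′ ∷ ps) u)
                 (subst (OnPath _ (suc x)) (sym (column-gap {p} {q} {d} {d′} y balance))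
                        (after-E (onPath-N-run-after (suc q) l)))
    ... | inj₁ (() , _)
    ... | inj₂ (x≡ , y≡) = inj₂ (suc-injective x≡ , +-cancelˡ-≡ (suc p) _ _ y≡)

+-tight : ∀ {m n o p} → m ≤ o → n ≤ p → m + n ≡ o + p → m ≡ o × n ≡ p
+-tight {m} {n} {o} {p} m≤o n≤p eq = m≡o , +-cancelˡ-≡ m n p (trans eq (cong (_+ p) (sym m≡o)))
  where
    m≡o : m ≡ o
    m≡o = ≤-antisym m≤o (+-cancelʳ-≤ p o m (subst (_≤ m + p) eq (+-monoʳ-≤ m n≤p)))

meetOnlyAtEnds⇒touchOnlyAtEnds : ∀ ps qs → MeetOnlyAtEnds (upperPath ps) (lowerPath qs) →
  TouchOnlyAtEnds 0 ps qs
meetOnlyAtEnds⇒touchOnlyAtEnds ps qs meet {x} {y} u l+0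
  with meet (x + y) (x + y) (onPath-length u) (onPath-length l)
            (trans (pos-take-onPath u) (sym (pos-take-onPath l)))
  where
    l = subst (OnPath (lowerPath qs) x) (+-identityʳ y) l+0
... | inj₁ (x+y≡0 , _) = inj₁ (m+n≡0⇒m≡0 x x+y≡0 , m+n≡0⇒n≡0 x x+y≡0)
... | inj₂ (x+y≡ , _) = inj₂ (+-tight x≤ y≤ (trans x+y≡ (length-upperPath ps)))
  where
    x≤ = subst (x ≤_) (cong proj₁ (pos-upperPath ps)) (proj₁ (onPath-bounded u))
    y≤ = subst (y ≤_) (cong proj₂ (pos-upperPath ps)) (proj₂ (onPath-bounded u))

touchOnlyAtEnds⇒meetOnlyAtEnds : ∀ ps qs → length ps ≡ length qs → total ps ≡ total qs →
  TouchOnlyAtEnds 0 ps qs → MeetOnlyAtEnds (upperPath ps) (lowerPath qs)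
touchOnlyAtEnds⇒meetOnlyAtEnds ps qs len tot touch i j i≤ j≤ same
  with touch (onPath-take i (upperPath ps))
             (subst₂ (OnPath (lowerPath qs)) (cong proj₁ (sym same))
                     (trans (cong proj₂ (sym same)) (sym (+-identityʳ _))) (onPath-take j (lowerPath qs)))
     | sym (endX+endY-take i (upperPath ps) i≤)
     | trans (sym (endX+endY-take j (lowerPath qs) j≤)) (cong (λ (x , y) → x + y) (sym same))
... | inj₁ (x≡0 , y≡0) | i≡ | j≡ =
  inj₁ (trans i≡ (cong₂ _+_ x≡0 y≡0) , trans j≡ (cong₂ _+_ x≡0 y≡0))
... | inj₂ (x≡ , y≡) | i≡ | j≡ =
  inj₂ (trans i≡ (trans (cong₂ _+_ x≡ y≡) (sym (length-upperPath ps))) ,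
        trans j≡ (trans (cong₂ _+_ x≡ y≡) (trans (cong₂ _+_ len tot) (sym (length-lowerPath qs)))))

-- Step polyominoes

upperPath-view : ∀ t → NoEE (N ∷ t) →
  (∃[ p ] ∃[ ps ] N ∷ t ≡ upperPath (p ∷ ps)) ⊎ (∃[ u ] N ∷ t ≡ u ++ [ N ])
upperPath-view [] _ = inj₂ ([] , refl)
upperPath-view (N ∷ t) h with upperPath-view t h
... | inj₁ (p , ps , e) = inj₁ (suc p , ps , cong (N ∷_) e)
... | inj₂ (u , e) = inj₂ (N ∷ u , cong (N ∷_) e)
upperPath-view (E ∷ []) _ = inj₁ (0 , [] , refl)
upperPath-view (E ∷ N ∷ t) h with upperPath-view t h
... | inj₁ (p , ps , e) = inj₁ (0 , p ∷ ps , cong (λ s → N ∷ E ∷ s) e)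
... | inj₂ (u , e) = inj₂ (N ∷ E ∷ u , cong (λ s → N ∷ E ∷ s) e)

lowerPath-view : ∀ t → NoEE (E ∷ t) →
  (∃[ qs ] E ∷ t ≡ lowerPath qs) ⊎ (∃[ l ] E ∷ t ≡ l ++ [ E ])
N-run-view : ∀ t → NoEE (N ∷ t) →
  (∃[ q ] ∃[ qs ] N ∷ t ≡ replicate (suc q) N ++ lowerPath qs) ⊎ (∃[ l ] N ∷ t ≡ l ++ [ E ])

lowerPath-view [] _ = inj₂ ([] , refl)
lowerPath-view (N ∷ t) h with N-run-view t h
... | inj₁ (q , qs , e) = inj₁ (q ∷ qs , cong (E ∷_) e)
... | inj₂ (l , e) = inj₂ (E ∷ l , cong (E ∷_) e)

N-run-view [] _ = inj₁ (0 , [] , refl)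
N-run-view (N ∷ t) h with N-run-view t h
... | inj₁ (q , qs , e) = inj₁ (suc q , qs , cong (N ∷_) e)
... | inj₂ (l , e) = inj₂ (N ∷ l , cong (N ∷_) e)
N-run-view (E ∷ t) h with lowerPath-view t h
... | inj₁ (qs , e) = inj₁ (0 , qs , cong (N ∷_) e)
... | inj₂ (l , e) = inj₂ (N ∷ l , cong (N ∷_) e)

module _ {u l} (meet : MeetOnlyAtEnds (N ∷ u) (E ∷ l)) (same : pos (N ∷ u) ≡ pos (E ∷ l)) where

  private
    len : length u ≡ length l
    len = suc-injective (trans (length≡endX+endY {N ∷ u} same) (endX+endY≡length (E ∷ l)))

  -- Both prefixes of length i end on the line x + y = i, so equal heights would be a meeting point.
  lower-below-upper : ∀ k → suc k ≤ length u →
    endY (take (suc k) (E ∷ l)) < endY (take (suc k) (N ∷ u))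
  lower-below-upper zero _ = s≤s z≤n
  lower-below-upper (suc k) j≤L = ≤∧≢⇒< lo≤up lo≢up
    where
      j = suc (suc k)
      lo≤up : endY (take j (E ∷ l)) ≤ endY (take j (N ∷ u))
      lo≤up = ≤-trans (endY-take-suc-≤ (suc k) (E ∷ l))
                (≤-trans (lower-below-upper k (≤-trans (n≤1+n (suc k)) j≤L))
                         (endY-take-≤-suc (suc k) (N ∷ u)))
      j≤up = m≤n⇒m≤1+n j≤L
      j≤lo = subst (j ≤_) (cong suc len) j≤up
      lo≢up : endY (take j (E ∷ l)) ≢ endY (take j (N ∷ u))
      lo≢up e with meet j j j≤up j≤lo (cong₂ _,_ ex (sym e))
        where
          ex : endX (take j (N ∷ u)) ≡ endX (take j (E ∷ l))
          ex = +-cancelʳ-≡ _ _ _ (trans (endX+endY-take j (N ∷ u) j≤up)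
                 (trans (sym (endX+endY-take j (E ∷ l) j≤lo)) (cong (endX (take j (E ∷ l)) +_) e)))
      ... | inj₁ (() , _)
      ... | inj₂ (j≡ , _) = <⇒≢ (s≤s j≤L) j≡

  penultimate-gap : 1 ≤ length u → endY (take (length u) (E ∷ l)) < endY (take (length u) (N ∷ u))
  penultimate-gap L≥1 with m≤n⇒∃[o]m+o≡n L≥1
  ... | k , 1+k≡L = subst (λ i → endY (take i (E ∷ l)) < endY (take i (N ∷ u))) 1+k≡L
                          (lower-below-upper k (≤-reflexive 1+k≡L))

  upper-ends-with-E : ∀ u′ → 1 ≤ length u → N ∷ u ≢ u′ ++ [ N ]
  upper-ends-with-E u′ L≥1 up≡ = <⇒≱ (penultimate-gap L≥1) up≤lo
    where
      open ≤-Reasoning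
      L = length u
      L′≡L : length u′ ≡ L
      L′≡L = suc-injective (trans (sym (length-snoc u′ N)) (cong length (sym up≡)))
      up≤lo : endY (take L (N ∷ u)) ≤ endY (take L (E ∷ l))
      up≤lo = s≤s⁻¹ (begin
        suc (endY (take L (N ∷ u)))
          ≡⟨ cong suc (cong₂ (λ i s → endY (take i s)) (sym L′≡L) up≡) ⟩
        suc (endY (take (length u′) (u′ ++ [ N ])))
          ≡⟨ cong (λ s → suc (endY s)) (take-length-++ u′ [ N ]) ⟩
        suc (endY u′)                         ≡⟨ +-comm 1 (endY u′) ⟩
        endY u′ + 1                           ≡⟨ sym (endY-++ u′ [ N ]) ⟩
        endY (u′ ++ [ N ])                    ≡⟨ cong endY (sym up≡) ⟩
        endY (N ∷ u)                          ≡⟨ cong proj₂ same ⟩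
        endY (E ∷ l)                          ≡⟨ sym (endY-take-length (E ∷ l)) ⟩
        endY (take (suc (length l)) (E ∷ l))  ≡⟨ cong (λ i → endY (take (suc i) (E ∷ l))) (sym len) ⟩
        endY (take (suc L) (E ∷ l))           ≤⟨ endY-take-suc-≤ L (E ∷ l) ⟩
        suc (endY (take L (E ∷ l)))           ∎)

  lower-ends-with-N : ∀ l′ → 1 ≤ length u → E ∷ l ≢ l′ ++ [ E ]
  lower-ends-with-N l′ L≥1 lo≡ = <⇒≱ (penultimate-gap L≥1) up≤lo
    where
      open ≤-Reasoning
      L = length u
      L′≡L : length l′ ≡ L
      L′≡L = suc-injective
        (trans (sym (length-snoc l′ E)) (trans (cong length (sym lo≡)) (cong suc (sym len))))
      up≤lo : endY (take L (N ∷ u)) ≤ endY (take L (E ∷ l))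
      up≤lo = begin
        endY (take L (N ∷ u))                 ≤⟨ endY-take-≤-suc L (N ∷ u) ⟩
        endY (take (suc L) (N ∷ u))           ≡⟨ endY-take-length (N ∷ u) ⟩
        endY (N ∷ u)                          ≡⟨ cong proj₂ same ⟩
        endY (E ∷ l)                          ≡⟨ cong endY lo≡ ⟩
        endY (l′ ++ [ E ])                    ≡⟨ trans (endY-++ l′ [ E ]) (+-identityʳ (endY l′)) ⟩
        endY l′                               ≡⟨ cong endY (sym (take-length-++ l′ [ E ])) ⟩
        endY (take (length l′) (l′ ++ [ E ])) ≡⟨ cong₂ (λ i s → endY (take i s)) L′≡L (sym lo≡) ⟩
        endY (take L (E ∷ l))                 ∎

StepPolyomino : ℕ → ℕ → List Step × List Step → Set
StepPolyomino n w P = IsStepPolyomino P × width P ≡ w × height P ≡ suc n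

stepPolyomino-paths : ∀ {n k} up lo → StepPolyomino n (suc k) (up , lo) →
  ∃[ ps ] ∃[ qs ] up ≡ upperPath ps × lo ≡ lowerPath qs
stepPolyomino-paths (N ∷ u) [] (((_ , same , _) , _) , _ , height) =
  ⊥-elim (1+n≢0 (trans (sym height) (cong proj₂ same)))
stepPolyomino-paths (N ∷ u) (N ∷ l) (((_ , _ , meet) , _) , width , _)
  with meet 1 1 (s≤s z≤n) (s≤s z≤n) refl
... | inj₁ (() , _)
... | inj₂ (1≡ , _) = ⊥-elim (<⇒≢ (s≤s (endX≡suc⇒1≤length u width)) 1≡)
stepPolyomino-paths (N ∷ u) (E ∷ l) (((_ , same , meet) , noEEu , noEEl) , width , _)
  with upperPath-view u noEEu | lowerPath-view l noEEl | endX≡suc⇒1≤length u width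
... | inj₁ (p , ps , up≡) | inj₁ (qs , lo≡) | _ = p ∷ ps , qs , up≡ , lo≡
... | inj₂ (u′ , up≡) | _ | L≥1 = ⊥-elim (upper-ends-with-E meet same u′ L≥1 up≡)
... | inj₁ _ | inj₂ (l′ , lo≡) | L≥1 = ⊥-elim (lower-ends-with-N meet same l′ L≥1 lo≡)

Admissible : ℕ → ℕ → List ℕ × List ℕ → Set
Admissible n w (ps , qs) = length ps ≡ w × total ps ≡ suc n × total qs ≡ suc n × Separated 0 ps qs

pathsOf : List ℕ × List ℕ → List Step × List Step
pathsOf (ps , qs) = upperPath ps , lowerPath qs

partsOf : List Step × List Step → List ℕ × List ℕ
partsOf (up , lo) = upperParts up , lowerParts lo

partsOf-pathsOf : ∀ c → partsOf (pathsOf c) ≡ c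
partsOf-pathsOf (ps , qs) = cong₂ _,_ (upperParts-upperPath ps) (lowerParts-lowerPath qs)

pathsOf-partsOf : ∀ {n k} P → StepPolyomino n (suc k) P → pathsOf (partsOf P) ≡ P
pathsOf-partsOf (up , lo) sp with stepPolyomino-paths up lo sp
... | ps , qs , refl , refl = cong pathsOf (partsOf-pathsOf (ps , qs))

stepPolyomino⇒admissible : ∀ {n k} ps qs →
  StepPolyomino n (suc k) (pathsOf (ps , qs)) → Admissible n (suc k) (ps , qs)
stepPolyomino⇒admissible [] qs (_ , width , _) = ⊥-elim (0≢1+n width)
stepPolyomino⇒admissible (p ∷ ps) [] (((_ , same , _) , _) , _) =
  ⊥-elim (1+n≢0 (proj₁ (common-end (p ∷ ps) [] same)))
stepPolyomino⇒admissible (p ∷ ps) (q ∷ qs) (((_ , same , meet) , _) , width , height) =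
  trans (sym (cong proj₁ (pos-upperPath (p ∷ ps)))) width , total-up , trans (sym tot) total-up ,
  touchOnlyAtEnds⇒separated p ps q qs (suc-injective len)
    (meetOnlyAtEnds⇒touchOnlyAtEnds (p ∷ ps) (q ∷ qs) meet)
  where
    len = proj₁ (common-end (p ∷ ps) (q ∷ qs) same)
    tot = proj₂ (common-end (p ∷ ps) (q ∷ qs) same)
    total-up = trans (sym (cong proj₂ (pos-upperPath (p ∷ ps)))) height

admissible⇒stepPolyomino : ∀ {n w} ps qs → Admissible n w (ps , qs) → StepPolyomino n w (pathsOf (ps , qs))
admissible⇒stepPolyomino [] qs (_ , _ , _ , ())
admissible⇒stepPolyomino (p ∷ ps) qs (length≡ , total-up , total-lo , sep) =
  ((tt , same , meet) , noEE-upperPath (p ∷ ps) , noEE-lowerPath qs) ,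
  trans (cong proj₁ (pos-upperPath (p ∷ ps))) length≡ ,
  trans (cong proj₂ (pos-upperPath (p ∷ ps))) total-up
  where
    len = separated-length sep
    tot = trans total-up (sym total-lo)
    same = trans (pos-upperPath (p ∷ ps)) (trans (cong₂ _,_ len tot) (sym (pos-lowerPath qs)))
    meet = touchOnlyAtEnds⇒meetOnlyAtEnds (p ∷ ps) qs len tot (separated⇒touchOnlyAtEnds sep)

stepPolyominoes≅compositions : ∀ n k → Correspondence (StepPolyomino n (suc k)) (Admissible n (suc k))
stepPolyominoes≅compositions n k = record
  { to             = partsOf
  ; from           = pathsOf
  ; to-preserves   = λ P sp → stepPolyomino⇒admissible _ _
                                (subst (StepPolyomino n (suc k)) (sym (pathsOf-partsOf P sp)) sp)
  ; from-preserves = λ (ps , qs) → admissible⇒stepPolyomino ps qs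
  ; from∘to        = pathsOf-partsOf
  ; to∘from        = λ c _ → partsOf-pathsOf c
  }

-- Young diagrams as lists of runs

-- A run (v , c) stands for c + 1 parts equal to v.
expand : List (ℕ × ℕ) → List ℕ
expand [] = []
expand ((v , c) ∷ r) = replicate (suc c) v ++ expand r

consRun : ℕ → List (ℕ × ℕ) → List (ℕ × ℕ)
consRun a [] = [ a , 0 ]
consRun a ((v , c) ∷ r) with a ≟ v
... | yes _ = (v , suc c) ∷ r
... | no _ = (a , 0) ∷ (v , c) ∷ r

runs : List ℕ → List (ℕ × ℕ)
runs [] = []
runs (a ∷ l) = consRun a (runs l)

DistinctRuns : List (ℕ × ℕ) → Set
DistinctRuns = Linked (_≢_ on proj₁)

expand-consRun : ∀ a bs → expand (consRun a bs) ≡ a ∷ expand bs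
expand-consRun a [] = refl
expand-consRun a ((v , c) ∷ r) with a ≟ v
... | yes refl = refl
... | no _ = refl

expand-runs : ∀ l → expand (runs l) ≡ l
expand-runs [] = refl
expand-runs (a ∷ l) = trans (expand-consRun a (runs l)) (cong (a ∷_) (expand-runs l))

consRun-distinct : ∀ a bs → DistinctRuns bs → DistinctRuns (consRun a bs)
consRun-distinct a [] _ = [-]
consRun-distinct a ((v , c) ∷ r) distinct with a ≟ v | distinct
... | yes _ | [-] = [-]
... | yes _ | v≢v′ ∷ rest = v≢v′ ∷ rest
... | no a≢v | _ = a≢v ∷ distinct

runs-distinct : ∀ l → DistinctRuns (runs l)
runs-distinct [] = []
runs-distinct (a ∷ l) = consRun-distinct a (runs l) (runs-distinct l)

consRun-fresh : ∀ {v c} r → DistinctRuns ((v , c) ∷ r) → consRun v r ≡ (v , 0) ∷ r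
consRun-fresh [] _ = refl
consRun-fresh {v} ((v′ , _) ∷ _) (v≢v′ ∷ _) with v ≟ v′
... | yes v≡v′ = ⊥-elim (v≢v′ v≡v′)
... | no _ = refl

consRun-same : ∀ v c r → consRun v ((v , c) ∷ r) ≡ (v , suc c) ∷ r
consRun-same v c r with v ≟ v
... | yes _ = refl
... | no v≢v = ⊥-elim (v≢v refl)

runs-expand : ∀ bs → DistinctRuns bs → runs (expand bs) ≡ bs
runs-expand [] _ = refl
runs-expand ((v , c) ∷ r) distinct = runs-run c
  where
    runs-run : ∀ k → runs (replicate (suc k) v ++ expand r) ≡ (v , k) ∷ r
    runs-run zero =
      trans (cong (consRun v) (runs-expand r (Linked.tail distinct))) (consRun-fresh r distinct)
    runs-run (suc k) = trans (cong (consRun v) (runs-run k)) (consRun-same v k r)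

-- The runs of a diagram fitting in the staircase (m − 1, m − 2, …), with all values below u.
data StaircaseRuns : ℕ → ℕ → List (ℕ × ℕ) → Set where
  []  : ∀ {m u} → StaircaseRuns m u []
  run : ∀ {m u v c r} → 1 ≤ v → v < u → v + suc c ≤ m →
        StaircaseRuns (m ∸ suc c) v r → StaircaseRuns m u ((v , c) ∷ r)

staircaseRuns⇒distinct : ∀ {m u bs} → StaircaseRuns m u bs → DistinctRuns bs
staircaseRuns⇒distinct [] = []
staircaseRuns⇒distinct (run _ _ _ []) = [-]
staircaseRuns⇒distinct (run _ _ _ rest@(run _ v′<v _ _)) = >⇒≢ v′<v ∷ staircaseRuns⇒distinct rest

head-expand-below : ∀ {m v r} → StaircaseRuns m v r → Connected _>_ (just v) (List.head (expand r))
head-expand-below [] = just-nothing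
head-expand-below (run _ v′<v _ _) = just v′<v

>⇒≥-connected : ∀ {v b} → Connected _>_ (just v) b → Connected _≥_ (just v) b
>⇒≥-connected (just v>b) = just (<⇒≤ v>b)
>⇒≥-connected just-nothing = just-nothing

isPartition-run : ∀ k {v t} → 1 ≤ v → Connected _≥_ (just v) (List.head t) → IsPartition t →
  IsPartition (replicate k v ++ t)
isPartition-run k v≥1 v≥head (positive , decreasing) = ++⁺ (replicate⁺ k v≥1) positive , linked k
  where
    linked : ∀ k → Linked _≥_ (replicate k _ ++ _)
    linked zero = decreasing
    linked (suc zero) = v≥head ∷′ decreasing
    linked (suc (suc k)) = ≤-refl ∷ linked (suc k)

isPartition-run⁻ : ∀ k {v t} → IsPartition (replicate (suc k) v ++ t) →
  1 ≤ v × Connected _≥_ (just v) (List.head t) × IsPartition t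
isPartition-run⁻ zero (v≥1 ∷ positive , decreasing) =
  v≥1 , Linked.head′ decreasing , positive , Linked.tail decreasing
isPartition-run⁻ (suc k) (_ ∷ positive , decreasing) =
  isPartition-run⁻ k (positive , Linked.tail decreasing)

Fits : ℕ → List ℕ → Set
Fits m [] = ⊤
Fits m (a ∷ l) = a ≤ m ∸ 1 × Fits (m ∸ 1) l

fits⇒fitsStaircase : ∀ m l → Fits m l → FitsStaircase m l
fits⇒fitsStaircase m (a ∷ l) (a≤ , _) Fin.zero = a≤
fits⇒fitsStaircase m (a ∷ l) (_ , fits) (Fin.suc i) =
  subst (lookup l i ≤_) (∸-+-assoc m 1 (suc (toℕ i))) (fits⇒fitsStaircase (m ∸ 1) l fits i)

fitsStaircase⇒fits : ∀ m l → FitsStaircase m l → Fits m l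
fitsStaircase⇒fits m [] _ = tt
fitsStaircase⇒fits m (a ∷ l) fits =
  fits Fin.zero ,
  fitsStaircase⇒fits (m ∸ 1) l
    (λ i → subst (lookup l i ≤_) (sym (∸-+-assoc m 1 (suc (toℕ i)))) (fits (Fin.suc i)))

fits-head : ∀ m l → Fits m l → Connected _>_ (just (suc m)) (List.head l)
fits-head m [] _ = just-nothing
fits-head m (a ∷ l) (a≤ , _) = just (s≤s (≤-trans a≤ (m∸n≤m m 1)))

fits-run : ∀ k {m v t} → v + k ≤ m → Fits (m ∸ k) t → Fits m (replicate k v ++ t)
fits-run zero _ fits = fits
fits-run (suc k) {m} {v} {t} v+k<m fits =
  ∸-monoˡ-≤ 1 (≤-trans (s≤s (m≤m+n v k)) v+k<m′) ,
  fits-run k (∸-monoˡ-≤ 1 v+k<m′) (subst (λ m′ → Fits m′ t) (sym (∸-+-assoc m 1 k)) fits)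
  where
    v+k<m′ : suc (v + k) ≤ m
    v+k<m′ = subst (_≤ m) (+-suc v k) v+k<m

0<m≤n∸1⇒m<n : ∀ {m n} → 1 ≤ m → m ≤ n ∸ 1 → m < n
0<m≤n∸1⇒m<n {n = zero} 0<m m≤0 = ⊥-elim (<⇒≱ 0<m m≤0)
0<m≤n∸1⇒m<n {n = suc n} _ m≤n = s≤s m≤n

fits-run⁻ : ∀ k {m v t} → 1 ≤ v → Fits m (replicate (suc k) v ++ t) →
  v + suc k ≤ m × Fits (m ∸ suc k) t
fits-run⁻ zero {m} {v} v≥1 (v≤ , fits) = subst (_≤ m) (+-comm 1 v) (0<m≤n∸1⇒m<n v≥1 v≤) , fits
fits-run⁻ (suc k) {m} {v} {t} v≥1 (_ , fits) with fits-run⁻ k v≥1 fits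
... | v+k<m , fits′ =
  subst (_≤ m) (sym (+-suc v (suc k))) (0<m≤n∸1⇒m<n (≤-trans v≥1 (m≤m+n v (suc k))) v+k<m) ,
  subst (λ m′ → Fits m′ t) (∸-+-assoc m 1 (suc k)) fits′

corners-descent : ∀ {a b} l → b < a → corners (a ∷ b ∷ l) ≡ suc (corners (b ∷ l))
corners-descent {a} {b} l b<a with b <ᵇ a | <⇒<ᵇ b<a
... | true | _ = refl

corners-repeat : ∀ v l → corners (v ∷ v ∷ l) ≡ corners (v ∷ l)
corners-repeat v l with v <ᵇ v | <ᵇ⇒< v v
... | false | _ = refl
... | true | v<v = ⊥-elim (<-irrefl refl (v<v tt))

corners-run : ∀ k {v t} → 1 ≤ v → Connected _>_ (just v) (List.head t) →
  corners (replicate (suc k) v ++ t) ≡ suc (corners t)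
corners-run zero {t = []} (s≤s _) _ = refl
corners-run zero {t = b ∷ t} _ (just v>b) = corners-descent t v>b
corners-run (suc k) {v} {t} v≥1 v>head =
  trans (corners-repeat v (replicate k v ++ t)) (corners-run k v≥1 v>head)

staircaseRuns⇒diagram : ∀ {m u bs} → StaircaseRuns m u bs →
  IsPartition (expand bs) × Fits m (expand bs) × corners (expand bs) ≡ length bs
staircaseRuns⇒diagram [] = ([] , []) , tt , refl
staircaseRuns⇒diagram (run {c = c} v≥1 _ fit rest) with staircaseRuns⇒diagram rest
... | partition , fits , corners≡ =
  isPartition-run (suc c) v≥1 (>⇒≥-connected (head-expand-below rest)) partition ,
  fits-run (suc c) fit fits ,
  trans (corners-run c v≥1 (head-expand-below rest)) (cong suc corners≡)

distinct-head-below : ∀ {v c} r → DistinctRuns ((v , c) ∷ r) →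
  Connected _≥_ (just v) (List.head (expand r)) → Connected _>_ (just v) (List.head (expand r))
distinct-head-below [] _ _ = just-nothing
distinct-head-below ((v′ , _) ∷ _) (v≢v′ ∷ _) (just v≥v′) = just (≤∧≢⇒< v≥v′ (≢-sym v≢v′))

diagram⇒staircaseRuns : ∀ {m u} bs → DistinctRuns bs → Connected _>_ (just u) (List.head (expand bs)) →
  IsPartition (expand bs) → Fits m (expand bs) → StaircaseRuns m u bs
diagram⇒staircaseRuns [] _ _ _ _ = []
diagram⇒staircaseRuns ((v , c) ∷ r) distinct (just v<u) partition fits
  with isPartition-run⁻ c partition
... | v≥1 , v≥head , partition′ with fits-run⁻ c v≥1 fits
...   | fit , fits′ =
  run v≥1 v<u fit (diagram⇒staircaseRuns r (Linked.tail distinct)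
                     (distinct-head-below r distinct v≥head) partition′ fits′)

Diagram : ℕ → ℕ → List ℕ → Set
Diagram n k Λ = IsPartition Λ × FitsStaircase n Λ × corners Λ ≡ k

RunsOfDiagram : ℕ → ℕ → List (ℕ × ℕ) → Set
RunsOfDiagram n k bs = StaircaseRuns n (suc n) bs × length bs ≡ k

staircaseRuns≅diagrams : ∀ n k → Correspondence (RunsOfDiagram n k) (Diagram n k)
staircaseRuns≅diagrams n k = record
  { to             = expand
  ; from           = runs
  ; to-preserves   = to-preserves
  ; from-preserves = from-preserves
  ; from∘to        = λ bs (staircase , _) → runs-expand bs (staircaseRuns⇒distinct staircase)
  ; to∘from        = λ Λ _ → expand-runs Λ
  }
  where
    to-preserves : ∀ bs → RunsOfDiagram n k bs → Diagram n k (expand bs)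
    to-preserves bs (staircase , length≡) with staircaseRuns⇒diagram staircase
    ... | partition , fits , corners≡ =
      partition , fits⇒fitsStaircase n (expand bs) fits , trans corners≡ length≡

    from-preserves : ∀ Λ → Diagram n k Λ → RunsOfDiagram n k (runs Λ)
    from-preserves Λ diagram with subst (Diagram n k) (sym (expand-runs Λ)) diagram
    ... | partition , fitsStaircase , corners≡ =
      staircase , trans (sym (proj₂ (proj₂ (staircaseRuns⇒diagram staircase)))) corners≡
      where
        fits = fitsStaircase⇒fits n (expand (runs Λ)) fitsStaircase
        staircase = diagram⇒staircaseRuns (runs Λ) (runs-distinct Λ) (fits-head n _ fits) partition fits

-- Pairs of compositions as lists of runs

-- Applied to (a₂, …, a_w) and b, this lists the runs of the diagram of (a, b): the part
-- a_{i+1} + ⋯ + a_w with multiplicity b_i, for i < w.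
runsOf : List ℕ → List ℕ → List (ℕ × ℕ)
runsOf [] _ = []
runsOf (_ ∷ _) [] = []
runsOf (x ∷ r) (q ∷ qs) = (total (x ∷ r) , q) ∷ runsOf r qs

partsFrom : ℕ → List (ℕ × ℕ) → List ℕ
partsFrom S [] = [ S ∸ 1 ]
partsFrom S ((v , _) ∷ r) = (S ∸ suc v) ∷ partsFrom v r

multiplicities : ℕ → List (ℕ × ℕ) → List ℕ
multiplicities m [] = [ m ]
multiplicities m ((_ , c) ∷ r) = c ∷ multiplicities (m ∸ suc c) r

[m+1+n]∸[1+m]≡n : ∀ m n → m + suc n ∸ suc m ≡ n
[m+1+n]∸[1+m]≡n m n = trans (cong (_∸ suc m) (+-suc m n)) (m+n∸m≡n m n)

length-runsOf : ∀ r qs → length qs ≡ suc (length r) → length (runsOf r qs) ≡ length r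
length-runsOf [] qs _ = refl
length-runsOf (x ∷ r) (q ∷ qs) len = cong suc (length-runsOf r qs (suc-injective len))

runsOf-staircase : ∀ {d m p r qs} → Separated d (p ∷ r) qs →
  total qs ≡ suc m → total (p ∷ r) + d ≡ suc m → StaircaseRuns m (total (p ∷ r)) (runsOf r qs)
runsOf-staircase last _ _ = []
runsOf-staircase {qs = q ∷ []} (next _ _ _ ())
runsOf-staircase {d} {m} {p} {p′ ∷ r} {q ∷ q′ ∷ qs} (next d′ balance d′≥1 sep) total-lo total-up
  with suc-injective total-lo
... | refl = run (s≤s z≤n) (s≤s (m≤n+m v p)) fit
               (subst (λ m′ → StaircaseRuns m′ v (runsOf r (q′ ∷ qs))) (sym ([m+1+n]∸[1+m]≡n q t))
                      (runsOf-staircase sep refl v+d′≡))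
  where
    v = total (p′ ∷ r)
    t = q′ + total qs
    v+d′≡ : v + d′ ≡ suc t
    v+d′≡ = +-cancelˡ-≡ (suc q) _ _ (trans (sym (column-gap {p} {q} {d} {d′} v balance)) total-up)
    v≤t : v ≤ t
    v≤t = s≤s⁻¹ (subst (v <_) v+d′≡ (m<m+n v d′≥1))
    fit : v + suc q ≤ q + suc t
    fit = subst₂ _≤_ (+-comm (suc q) v) (sym (+-suc q t)) (+-monoʳ-≤ (suc q) v≤t)

length-partsFrom : ∀ S bs → length (partsFrom S bs) ≡ suc (length bs)
length-partsFrom S [] = refl
length-partsFrom S ((v , _) ∷ r) = cong suc (length-partsFrom v r)

total-partsFrom : ∀ {m S bs} → StaircaseRuns m S bs → 1 ≤ S → total (partsFrom S bs) ≡ S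
total-partsFrom {S = suc S} [] _ = cong suc (+-identityʳ S)
total-partsFrom {S = S} (run {v = v} v≥1 v<S _ rest) _ =
  trans (cong (λ x → suc (S ∸ suc v + x)) (total-partsFrom rest v≥1))
        (trans (sym (+-suc (S ∸ suc v) v)) (m∸n+n≡m v<S))

total-multiplicities : ∀ {m S bs} → StaircaseRuns m S bs → total (multiplicities m bs) ≡ suc m
total-multiplicities {m} [] = cong suc (+-identityʳ m)
total-multiplicities {m} (run {v = v} {c} _ _ fit rest) =
  cong suc (trans (cong (c +_) (total-multiplicities rest))
                  (trans (+-suc c (m ∸ suc c)) (m+[n∸m]≡n (≤-trans (m≤n+m (suc c) v) fit))))

separated-partsFrom : ∀ {d m S bs} → StaircaseRuns m S bs → S + d ≡ suc m →
  Separated d (partsFrom S bs) (multiplicities m bs)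
separated-partsFrom [] _ = last
separated-partsFrom {d} (run {v = v} {c} _ v<S fit rest) S+d≡
  with m≤n⇒∃[o]m+o≡n v<S | m≤n⇒∃[o]m+o≡n fit
... | s , refl | u , refl =
  next (suc u) balance (s≤s z≤n)
       (separated-partsFrom rest (trans (+-suc v u) (cong suc (sym remaining≡))))
  where
    rearrange : ∀ v c u → v + suc c + u ≡ suc c + (v + u)
    rearrange = solve-∀
    shift : ∀ v d s → suc v + (d + suc s) ≡ suc (suc v + s + d)
    shift = solve-∀
    shift′ : ∀ v c u → suc (suc (v + suc c + u)) ≡ suc v + (suc c + suc u)
    shift′ = solve-∀
    remaining≡ : v + suc c + u ∸ suc c ≡ v + u
    remaining≡ = trans (cong (_∸ suc c) (rearrange v c u)) (m+n∸m≡n (suc c) (v + u))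
    balance : d + suc (suc v + s ∸ suc v) ≡ suc c + suc u
    balance = trans (cong (λ x → d + suc x) (m+n∸m≡n (suc v) s))
      (+-cancelˡ-≡ (suc v) _ _ (trans (shift v d s) (trans (cong suc S+d≡) (shift′ v c u))))

partsFrom-runsOf : ∀ p r qs → length qs ≡ suc (length r) →
  partsFrom (total (p ∷ r)) (runsOf r qs) ≡ p ∷ r
partsFrom-runsOf p [] qs _ = cong [_] (+-identityʳ p)
partsFrom-runsOf p (x ∷ r) (q ∷ qs) len =
  cong₂ _∷_ (m+n∸n≡m p (total (x ∷ r))) (partsFrom-runsOf x r qs (suc-injective len))

multiplicities-runsOf : ∀ m r qs → length qs ≡ suc (length r) → total qs ≡ suc m →
  multiplicities m (runsOf r qs) ≡ qs
multiplicities-runsOf m [] (q ∷ []) _ total≡ =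
  cong [_] (sym (trans (sym (+-identityʳ q)) (suc-injective total≡)))
multiplicities-runsOf m (x ∷ r) (q ∷ q′ ∷ qs) len total≡ with suc-injective total≡
... | refl =
  cong (q ∷_) (trans (cong (λ m′ → multiplicities m′ (runsOf r (q′ ∷ qs)))
                           ([m+1+n]∸[1+m]≡n q (q′ + total qs)))
                     (multiplicities-runsOf (q′ + total qs) r (q′ ∷ qs) (suc-injective len) refl))

runsOf-partsFrom-∷ : ∀ S bs q qs →
  runsOf (partsFrom S bs) (q ∷ qs) ≡ (total (partsFrom S bs) , q) ∷ runsOf (drop 1 (partsFrom S bs)) qs
runsOf-partsFrom-∷ S [] q qs = refl
runsOf-partsFrom-∷ S (_ ∷ _) q qs = refl

runsOf-partsFrom : ∀ {m S bs} → StaircaseRuns m S bs →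
  runsOf (drop 1 (partsFrom S bs)) (multiplicities m bs) ≡ bs
runsOf-partsFrom [] = refl
runsOf-partsFrom {m} (run {v = v} {c} {r} v≥1 _ _ rest) =
  trans (runsOf-partsFrom-∷ v r c (multiplicities (m ∸ suc c) r))
        (cong₂ _∷_ (cong (_, c) (total-partsFrom rest v≥1)) (runsOf-partsFrom rest))

compositions≅staircaseRuns : ∀ n k → Correspondence (Admissible n (suc k)) (RunsOfDiagram n k)
compositions≅staircaseRuns n k = record
  { to             = λ (ps , qs) → runsOf (drop 1 ps) qs
  ; from           = λ bs → partsFrom (suc n) bs , multiplicities n bs
  ; to-preserves   = to-preserves
  ; from-preserves = λ bs (staircase , length≡) →
      trans (length-partsFrom (suc n) bs) (cong suc length≡) ,
      total-partsFrom staircase (s≤s z≤n) , total-multiplicities staircase ,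
      separated-partsFrom staircase (+-identityʳ (suc n))
  ; from∘to        = from∘to
  ; to∘from        = λ bs (staircase , _) → runsOf-partsFrom staircase
  }
  where
    to-preserves : ∀ c → Admissible n (suc k) c →
      RunsOfDiagram n k (runsOf (drop 1 (proj₁ c)) (proj₂ c))
    to-preserves ([] , qs) (_ , _ , _ , ())
    to-preserves (p ∷ r , qs) (length≡ , total-up , total-lo , sep) =
      subst (λ S → StaircaseRuns n S (runsOf r qs)) total-up
            (runsOf-staircase sep total-lo (trans (+-identityʳ _) total-up)) ,
      trans (length-runsOf r qs (sym (separated-length sep))) (suc-injective length≡)

    from∘to : ∀ c → Admissible n (suc k) c →
      (partsFrom (suc n) (runsOf (drop 1 (proj₁ c)) (proj₂ c)) ,
       multiplicities n (runsOf (drop 1 (proj₁ c)) (proj₂ c))) ≡ c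
    from∘to ([] , qs) (_ , _ , _ , ())
    from∘to (p ∷ r , qs) (_ , total-up , total-lo , sep) =
      cong₂ _,_ (subst (λ S → partsFrom S (runsOf r qs) ≡ p ∷ r) total-up (partsFrom-runsOf p r qs len))
                (multiplicities-runsOf n r qs len total-lo)
      where len = sym (separated-length sep)

theorem3p4 : (n w : ℕ) → 1 ≤ n → 1 ≤ w →
    Bijective {List Step × List Step} {List ℕ}
      {λ P → IsStepPolyomino P × width P ≡ w × height P ≡ suc n}
      {λ Λ → IsPartition Λ × FitsStaircase n Λ × corners Λ ≡ w ∸ 1}
theorem3p4 n zero _ ()
theorem3p4 n (suc k) _ _ = correspondence⇒bijective
  (stepPolyominoes≅compositions n k ⨾ compositions≅staircaseRuns n k ⨾ staircaseRuns≅diagrams n k)
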